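{- Let $m\ge4$ be an integer and $n$ a prime. There exists a Type II solution $(x,y,z)\in\mathbb N^3$ of $\frac mn=\frac1x+\frac1y+\frac1z$ if and only if there exist $a,b,e\in\mathbb N$ with $e\mid a+b$ and $mab\mid n+e$.
   Context: $\mathbb N$ denotes the positive integers. A solution $(x,y,z)\in\mathbb N^3$ of $\frac mn=\frac1x+\frac1y+\frac1z$ is of Type II if $n$ divides both $y$ and $z$ but $n$ is coprime to $x$. -}

module Defs where

open import Data.Nat using (ℕ; _+_; _*_; _<_)
open import Data.Nat.Divisibility using (_∣_)
open import Data.Nat.Coprimality using (Coprime)
open import Data.Product using (_×_)
open import Relation.Binary.PropositionalEquality using (_≡_)

-- (x , y , z) positive naturals solve  m / n = 1/x + 1/y + 1/z  (n > 0),
-- written with denominators cleared:  m * x * y * z = n * (y*z + x*z + x*y).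
IsSolution : ℕ → ℕ → ℕ → ℕ → ℕ → Set
IsSolution m n x y z =
  (0 < x) × (0 < y) × (0 < z) × (m * x * y * z ≡ n * (y * z + x * z + x * y))

IsTypeII : ℕ → ℕ → ℕ → ℕ → ℕ → Set
IsTypeII m n x y z = IsSolution m n x y z × (n ∣ y) × (n ∣ z) × Coprime n x

{-# OPTIONS --safe #-}
module Submission where

-- With y = n y′ and z = n z′ the equation reads (m x − n) y′ z′ = x (y′ + z′). Put
-- e = m x − n and y′ = a d, z′ = b d with d = gcd y′ z′, so that e d a b = x (a + b);
-- as a and b are coprime to a + b, x = t a b and e d = t (a + b). A common divisor of
-- e and t divides x and n = m x − e, so e is coprime to t and divides a + b, while
-- n + e = m x = t · m a b.
-- Conversely, from a + b = f e and n + e = t · m a b the triple (a b t, a t f n, b t f n)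
-- is a solution; since e ≤ a + b ≤ 2x and m ≥ 4 we get n ≥ 2x > x, so the prime n is
-- coprime to x. Primality and m ≥ 4 are only needed in this converse direction.

open import Defs
open import Data.Nat
  using (ℕ; suc; _+_; _*_; _∸_; _<_; _≤_; NonZero; z<s; >-nonZero; >-nonZero⁻¹)
open import Data.Nat.Properties
open import Data.Nat.Divisibility
  using (_∣_; divides; divides-refl; ∣-trans; ∣m+n∣m⇒∣n; ∣⇒≤; *-monoʳ-∣; m∣m*n; n∣m*n)
open import Data.Nat.Coprimality
  using (Coprime; coprime-divisor; coprime-+; GCD≡1⇒coprime; prime⇒coprime)
  renaming (sym to coprime-sym)
open import Data.Nat.GCD using (gcd; GCD; gcd-GCD; GCD-*; gcd[m,n]∣m; gcd[m,n]∣n; gcd[m,n]≢0)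
open import Data.Nat.Primality using (Prime; prime⇒nonZero)
open import Data.Nat.Tactic.RingSolver using (solve)
open import Data.List.Base using (_∷_; [])
open import Data.Product using (_×_; _,_; proj₁; ∃-syntax)
open import Data.Sum using (inj₁)
open import Function.Bundles using (_⇔_; mk⇔; Equivalence)
open import Relation.Binary.PropositionalEquality
  using (_≡_; refl; sym; trans; cong; subst; subst₂; module ≡-Reasoning)

*-positive : ∀ {a b} → 0 < a → 0 < b → 0 < a * b
*-positive {suc _} {suc _} _ _ = z<s

*-positiveˡ : ∀ a b → 0 < a * b → 0 < a
*-positiveˡ (suc _) _ _ = z<s

*-positiveʳ : ∀ a b → 0 < a * b → 0 < b
*-positiveʳ a b ab>0 = *-positiveˡ b a (subst (0 <_) (*-comm a b) ab>0)

coprime⇒*∣ : ∀ {a b x} → Coprime a b → a ∣ x → b ∣ x → a * b ∣ x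
coprime⇒*∣ {a} {b} a⊥b (divides-refl k) b∣ka = subst (a * b ∣_) (*-comm a k) (*-monoʳ-∣ a b∣k)
  where
  b∣k : b ∣ k
  b∣k = coprime-divisor (coprime-sym a⊥b) (subst (b ∣_) (*-comm k a) b∣ka)

coprime⇒*∣[+]*⇒*∣ : ∀ {a b x} → Coprime a b → a * b ∣ (a + b) * x → a * b ∣ x
coprime⇒*∣[+]*⇒*∣ {a} {b} a⊥b ab∣[a+b]x = coprime⇒*∣ a⊥b
  (coprime-divisor a⊥a+b (∣-trans (m∣m*n b) ab∣[a+b]x))
  (coprime-divisor b⊥a+b (∣-trans (n∣m*n a) ab∣[a+b]x))
  where
  a⊥a+b : Coprime a (a + b)
  a⊥a+b = coprime-sym (coprime-+ (coprime-sym a⊥b))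
  b⊥a+b : Coprime b (a + b)
  b⊥a+b = subst (Coprime b) (+-comm b a) (coprime-sym (coprime-+ a⊥b))

gcd-factorisation : ∀ y z → 0 < y → 0 < z →
  ∃[ d ] ∃[ a ] ∃[ b ] (0 < d) × (0 < a) × (0 < b) × Coprime a b × (y ≡ a * d) × (z ≡ b * d)
gcd-factorisation y z y>0 z>0
  with divides a y≡ag ← gcd[m,n]∣m y z | divides b z≡bg ← gcd[m,n]∣n y z =
  g , a , b , g>0 , a>0 , b>0 , GCD≡1⇒coprime (GCD-* {{>-nonZero g>0}} gcd[ag,bg]≡1*g) , y≡ag , z≡bg
  where
  g : ℕ
  g = gcd y z
  g>0 : 0 < g
  g>0 = n≢0⇒n>0 (gcd[m,n]≢0 y z (inj₁ (n>0⇒n≢0 y>0)))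
  a>0 : 0 < a
  a>0 = *-positiveˡ a g (subst (0 <_) y≡ag y>0)
  b>0 : 0 < b
  b>0 = *-positiveˡ b g (subst (0 <_) z≡bg z>0)
  gcd[ag,bg]≡1*g : GCD (a * g) (b * g) (1 * g)
  gcd[ag,bg]≡1*g = subst₂ (λ u v → GCD u v (1 * g)) y≡ag z≡bg
    (subst (GCD y z) (sym (*-identityˡ g)) (gcd-GCD y z))

coprime-parametrisation : ∀ {a b c x} → Coprime a b → 0 < a * b → c * (a * b) ≡ x * (a + b) →
  ∃[ t ] (x ≡ t * (a * b)) × (c ≡ t * (a + b))
coprime-parametrisation {a} {b} {c} {x} a⊥b ab>0 eq
  with divides-refl t ← coprime⇒*∣[+]*⇒*∣ a⊥b (divides c (trans (*-comm (a + b) x) (sym eq))) =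
  t , refl , *-cancelʳ-≡ c (t * (a + b)) (a * b) {{>-nonZero ab>0}} (begin
    c * (a * b)           ≡⟨ eq ⟩
    t * (a * b) * (a + b) ≡⟨ solve (t ∷ a ∷ b ∷ []) ⟩
    t * (a + b) * (a * b) ∎)
  where open ≡-Reasoning

common-factor-cancel : ∀ e x a b {d} → 0 < d → e * (a * d * (b * d)) ≡ x * (a * d + b * d) →
  e * d * (a * b) ≡ x * (a + b)
common-factor-cancel e x a b {d} d>0 eq = *-cancelˡ-≡ _ _ d {{>-nonZero d>0}} (begin
  d * (e * d * (a * b)) ≡⟨ solve (d ∷ e ∷ a ∷ b ∷ []) ⟩
  e * (a * d * (b * d)) ≡⟨ eq ⟩
  x * (a * d + b * d)   ≡⟨ solve (x ∷ a ∷ b ∷ d ∷ []) ⟩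
  d * (x * (a + b))     ∎)
  where open ≡-Reasoning

unit-fraction-pair-parametrisation : ∀ e x {y z} → 0 < y → 0 < z → e * (y * z) ≡ x * (y + z) →
  ∃[ a ] ∃[ b ] ∃[ t ] (0 < a) × (0 < b) × (x ≡ t * (a * b)) × (e ∣ t * (a + b))
unit-fraction-pair-parametrisation e x {y} {z} y>0 z>0 eq with gcd-factorisation y z y>0 z>0
... | d , a , b , d>0 , a>0 , b>0 , a⊥b , refl , refl
  with t , x≡tab , ed≡t[a+b] ← coprime-parametrisation a⊥b (*-positive a>0 b>0)
                                 (common-factor-cancel e x a b d>0 eq) =
  a , b , t , a>0 , b>0 , x≡tab , divides d (trans (sym ed≡t[a+b]) (*-comm e d))

excess : ∀ k n {y s} → k * y ≡ n * y + s → 0 < s → ∃[ e ] (0 < e) × (n + e ≡ k) × (e * y ≡ s)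
excess k n {y} {s} eq s>0 = k ∸ n , m<n⇒0<n∸m n<k , n+[k∸n]≡k , +-cancelˡ-≡ (n * y) _ s (begin
  n * y + (k ∸ n) * y ≡⟨ *-distribʳ-+ y n (k ∸ n) ⟨
  (n + (k ∸ n)) * y   ≡⟨ cong (_* y) n+[k∸n]≡k ⟩
  k * y               ≡⟨ eq ⟩
  n * y + s           ∎)
  where
  open ≡-Reasoning
  n<k : n < k
  n<k = *-cancelʳ-< y n k (subst (n * y <_) (sym eq) (m<m+n (n * y) s>0))
  n+[k∸n]≡k : n + (k ∸ n) ≡ k
  n+[k∸n]≡k = m+[n∸m]≡n (<⇒≤ n<k)

coprime-excess : ∀ m {n x e} → Coprime n x → n + e ≡ m * x → Coprime e x
coprime-excess m {n} {x} {e} n⊥x n+e≡mx {c} (c∣e , c∣x) = n⊥x (c∣n , c∣x)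
  where
  c∣e+n : c ∣ e + n
  c∣e+n = subst (c ∣_) (trans (sym n+e≡mx) (+-comm n e)) (∣-trans c∣x (n∣m*n m))
  c∣n : c ∣ n
  c∣n = ∣m+n∣m⇒∣n c∣e+n c∣e

scaled-solution-equation⇔ : ∀ m n x y z .{{_ : NonZero n}} →
  (m * x * (y * n) * (z * n) ≡ n * (y * n * (z * n) + x * (z * n) + x * (y * n)))
  ⇔ (m * x * (y * z) ≡ n * (y * z) + x * (y + z))
scaled-solution-equation⇔ m n x y z = mk⇔
  (λ eq → *-cancelˡ-≡ _ _ (n * n) {{m*n≢0 n n}} (trans (sym lhs) (trans eq rhs)))
  (λ eq → trans lhs (trans (cong (n * n *_) eq) (sym rhs)))
  where
  lhs : m * x * (y * n) * (z * n) ≡ n * n * (m * x * (y * z))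
  lhs = solve (m ∷ n ∷ x ∷ y ∷ z ∷ [])
  rhs : n * (y * n * (z * n) + x * (z * n) + x * (y * n)) ≡ n * n * (n * (y * z) + x * (y + z))
  rhs = solve (n ∷ x ∷ y ∷ z ∷ [])

typeII⇒parameters : ∀ {m n x y z} .{{_ : NonZero n}} → IsTypeII m n x y z →
  ∃[ a ] ∃[ b ] ∃[ e ] ((0 < a) × (0 < b) × (0 < e) × (e ∣ a + b) × (m * a * b ∣ n + e))
typeII⇒parameters {m} {n} {x}
  ((x>0 , y>0 , z>0 , eq) , divides-refl y′ , divides-refl z′ , n⊥x)
  with y′>0 ← *-positiveˡ y′ n y>0 | z′>0 ← *-positiveˡ z′ n z>0
  with e , e>0 , n+e≡mx , e[y′z′]≡x[y′+z′] ← excess (m * x) n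
         (Equivalence.to (scaled-solution-equation⇔ m n x y′ z′) eq)
         (*-positive x>0 (≤-trans y′>0 (m≤m+n y′ z′)))
  with a , b , t , a>0 , b>0 , refl , e∣t[a+b] ←
         unit-fraction-pair-parametrisation e x y′>0 z′>0 e[y′z′]≡x[y′+z′]
  = a , b , e , a>0 , b>0 , e>0 , coprime-divisor e⊥t e∣t[a+b] , divides t n+e≡t[mab]
  where
  e⊥t : Coprime e t
  e⊥t (c∣e , c∣t) = coprime-excess m n⊥x n+e≡mx (c∣e , ∣-trans c∣t (m∣m*n (a * b)))
  n+e≡t[mab] : n + e ≡ t * (m * a * b)
  n+e≡t[mab] = begin
    n + e             ≡⟨ n+e≡mx ⟩
    m * (t * (a * b)) ≡⟨ solve (m ∷ t ∷ a ∷ b ∷ []) ⟩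
    t * (m * a * b)   ∎
    where open ≡-Reasoning

small-excess⇒< : ∀ {m x e n} → 4 ≤ m → 0 < x → e ≤ x + x → m * x ≡ n + e → x < n
small-excess⇒< {m} {x} {e} {n} 4≤m x>0 e≤2x mx≡n+e = <-≤-trans (m<m+n x x>0) 2x≤n
  where
  open ≤-Reasoning
  2x≤n : x + x ≤ n
  2x≤n = +-cancelʳ-≤ (x + x) (x + x) n (begin
    x + x + (x + x) ≡⟨ solve (x ∷ []) ⟩
    4 * x           ≤⟨ *-monoˡ-≤ x 4≤m ⟩
    m * x           ≡⟨ mx≡n+e ⟩
    n + e           ≤⟨ +-monoʳ-≤ n e≤2x ⟩
    n + (x + x)     ∎)

parameters⇒solution : ∀ {m n a b e f t} .{{_ : NonZero n}} → 0 < a → 0 < b →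
  a + b ≡ f * e → m * (a * b * t) ≡ n + e →
  IsSolution m n (a * b * t) (a * t * f * n) (b * t * f * n)
parameters⇒solution {m} {n} {a} {b} {e} {f} {t} a>0 b>0 a+b≡fe mx≡n+e =
  x>0 , *-positive y′>0 n>0 , *-positive z′>0 n>0 ,
  Equivalence.from (scaled-solution-equation⇔ m n x y′ z′) reduced
  where
  open ≡-Reasoning
  x y′ z′ : ℕ
  x = a * b * t
  y′ = a * t * f
  z′ = b * t * f
  n>0 : 0 < n
  n>0 = >-nonZero⁻¹ n
  x>0 : 0 < x
  x>0 = *-positiveʳ m x (subst (0 <_) (sym mx≡n+e) (≤-trans n>0 (m≤m+n n e)))
  t>0 : 0 < t
  t>0 = *-positiveʳ (a * b) t x>0
  f>0 : 0 < f
  f>0 = *-positiveˡ f e (subst (0 <_) a+b≡fe (≤-trans a>0 (m≤m+n a b)))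
  y′>0 : 0 < y′
  y′>0 = *-positive (*-positive a>0 t>0) f>0
  z′>0 : 0 < z′
  z′>0 = *-positive (*-positive b>0 t>0) f>0
  e[y′z′]≡x[y′+z′] : e * (y′ * z′) ≡ x * (y′ + z′)
  e[y′z′]≡x[y′+z′] = begin
    e * (a * t * f * (b * t * f))       ≡⟨ solve (e ∷ a ∷ b ∷ t ∷ f ∷ []) ⟩
    a * b * t * t * f * (f * e)         ≡⟨ cong (a * b * t * t * f *_) a+b≡fe ⟨
    a * b * t * t * f * (a + b)         ≡⟨ solve (a ∷ b ∷ t ∷ f ∷ []) ⟩
    a * b * t * (a * t * f + b * t * f) ∎
  reduced : m * x * (y′ * z′) ≡ n * (y′ * z′) + x * (y′ + z′)
  reduced = begin
    m * x * (y′ * z′)             ≡⟨ cong (_* (y′ * z′)) mx≡n+e ⟩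
    (n + e) * (y′ * z′)           ≡⟨ *-distribʳ-+ (y′ * z′) n e ⟩
    n * (y′ * z′) + e * (y′ * z′) ≡⟨ cong (n * (y′ * z′) +_) e[y′z′]≡x[y′+z′] ⟩
    n * (y′ * z′) + x * (y′ + z′) ∎

parameters⇒typeII : ∀ {m n a b e} → 4 ≤ m → Prime n → 0 < a → 0 < b →
  e ∣ a + b → m * a * b ∣ n + e → ∃[ x ] ∃[ y ] ∃[ z ] IsTypeII m n x y z
parameters⇒typeII {m} {n} {a} {b} {e} 4≤m n-prime a>0 b>0
  e∣a+b@(divides f a+b≡fe) (divides t n+e≡t[mab]) =
  x , a * t * f * n , b * t * f * n ,
  solution , n∣m*n (a * t * f) , n∣m*n (b * t * f) , prime⇒coprime n-prime {{>-nonZero x>0}} x<n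
  where
  instance
    n≢0 : NonZero n
    n≢0 = prime⇒nonZero n-prime
  x : ℕ
  x = a * b * t
  mx≡n+e : m * x ≡ n + e
  mx≡n+e = begin
    m * (a * b * t) ≡⟨ solve (m ∷ a ∷ b ∷ t ∷ []) ⟩
    t * (m * a * b) ≡⟨ n+e≡t[mab] ⟨
    n + e           ∎
    where open ≡-Reasoning
  solution : IsSolution m n x (a * t * f * n) (b * t * f * n)
  solution = parameters⇒solution {m} a>0 b>0 a+b≡fe mx≡n+e
  x>0 : 0 < x
  x>0 = proj₁ solution
  x<n : x < n
  x<n = small-excess⇒< 4≤m x>0 (≤-trans e≤a+b (+-mono-≤ a≤x b≤x)) mx≡n+e
    where
    e≤a+b : e ≤ a + b
    e≤a+b = ∣⇒≤ {{>-nonZero (≤-trans a>0 (m≤m+n a b))}} e∣a+b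
    a≤x : a ≤ x
    a≤x = ∣⇒≤ {{>-nonZero x>0}} (∣-trans (m∣m*n b) (m∣m*n t))
    b≤x : b ≤ x
    b≤x = ∣⇒≤ {{>-nonZero x>0}} (∣-trans (n∣m*n a) (m∣m*n t))

corollary2p4 : (m n : ℕ) → 4 ≤ m → Prime n →
    (∃[ x ] ∃[ y ] ∃[ z ] IsTypeII m n x y z)
    ⇔ (∃[ a ] ∃[ b ] ∃[ e ] ((0 < a) × (0 < b) × (0 < e) × (e ∣ a + b) × (m * a * b ∣ n + e)))
corollary2p4 m n 4≤m n-prime = mk⇔
  (λ (_ , _ , _ , typeII) → typeII⇒parameters {m} {{prime⇒nonZero n-prime}} typeII)
  (λ (_ , _ , _ , a>0 , b>0 , _ , e∣a+b , mab∣n+e) →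
     parameters⇒typeII 4≤m n-prime a>0 b>0 e∣a+b mab∣n+e)
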